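{- (Backward modularity.) Let $\alpha\colon L \rightharpoonup R$, $\beta\colon G \rightharpoonup H$ and $\gamma\colon S \rightharpoonup T$ be rules, and let $f\colon L\to G$, $f_1\colon L\to S$, $g_1\colon R\to T$, $g_2\colon T\to H$ be matches such that (i) there is a derivation of the comatch $g_2\circ g_1$ from the match $f$ by $\alpha$ with corule $\beta$, and (ii) there is a derivation of the comatch $f_1$ from the match $g_1$ by the reverse rule $\alpha^\dagger$ with corule $\gamma^\dagger$. Then there is a unique match $f_2\colon S\to G$ such that $f_2\circ f_1=f$, the diagram commutes in the category of graphs and partial morphisms ($g_1\circ\alpha=\gamma\circ f_1$ and $g_2\circ\gamma=\beta\circ f_2$), and it is a vertical composition of derivations, i.e. $f_1\Rightarrow_\alpha g_1$ with corule $\gamma$ and $f_2\Rightarrow_\gamma g_2$ with corule $\beta$.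
   Context: A directed multigraph $G$ consists of finite sets $V_G$, $E_G$ and maps $s_G,t_G\colon E_G\to V_G$. A graph morphism $f\colon G\to H$ is a pair of maps on nodes and edges commuting with sources and targets. A match is a morphism injective on nodes and edges. A partial graph morphism $G\rightharpoonup H$ is a span $G\xleftarrow{p_1}K\xrightarrow{p_2}H$ with $p_1$ a monomorphism; graphs and partial morphisms form a category $\mathbf{Grph}_*$, total morphisms being regarded as partial ones. A rule $\alpha\colon L\rightharpoonup R$ is a span $L\xleftarrow{\alpha_1}K\xrightarrow{\alpha_2}R$ of matches; its reverse is $\alpha^\dagger:=(\alpha_2,\alpha_1)\colon R\rightharpoonup L$. Final pullback complement (FPBC) of $X\xrightarrow{f_1}Y\xrightarrow{f_2}Z$: a pair $X\xrightarrow{g_1}W\xrightarrow{g_2}Z$ making a pullback square with $g_2\circ g_1=f_2\circ f_1$, such that for every pullback square $P\xrightarrow{f_1'}Y\xrightarrow{f_2}Z\xleftarrow{g_2'}Q\xleftarrow{g_1'}P$ and $p\colon P\to X$ with $f_1\circ p=f_1'$ there is a unique $u\colon Q\to W$ with $g_2\circ u=g_2'$, $u\circ g_1'=g_1\circ p$. A derivation of a comatch $g\colon R\to H$ from a match $f\colon L\to G$ by a rule $\alpha=(\alpha_1\colon K\to L,\alpha_2\colon K\to R)$ consists of a match $h\colon K\to D$ and morphisms $\beta_1\colon D\to G$, $\beta_2\colon D\to H$ such that $K\xrightarrow{h}D\xrightarrow{\beta_1}G$ is an FPBC of $K\xrightarrow{\alpha_1}L\xrightarrow{f}G$, the square $\alpha_2,h,g,\beta_2$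 is a pushout of graphs, $g$ is a match and $\beta=(\beta_1,\beta_2)$ is a rule (the corule). Equivalently, a pushout of $\alpha$ along $f$ in $\mathbf{Grph}_*$. Notation: $f\Rightarrow_\alpha g$. -}

module Defs where

open import Data.Nat using (ℕ)
open import Data.Fin using (Fin)
open import Data.Product using (Σ; Σ-syntax; _×_; _,_)
open import Relation.Binary.PropositionalEquality using (_≡_)
open import Function using (Injective)

record Graph : Set where
  field
    nV  : ℕ
    nE  : ℕ
    src : Fin nE → Fin nV
    tgt : Fin nE → Fin nV
open Graph public

record Hom (G H : Graph) : Set where
  field
    fV    : Fin (nV G) → Fin (nV H)
    fE    : Fin (nE G) → Fin (nE H)
    src-∘ : ∀ e → fV (src G e) ≡ src H (fE e)
    tgt-∘ : ∀ e → fV (tgt G e) ≡ tgt H (fE e)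
open Hom public

open import Relation.Binary.PropositionalEquality using (refl; cong; trans)

idH : ∀ {G} → Hom G G
idH = record { fV = λ v → v ; fE = λ e → e ; src-∘ = λ _ → refl ; tgt-∘ = λ _ → refl }

infixr 9 _∘H_
_∘H_ : ∀ {A B C} → Hom B C → Hom A B → Hom A C
g ∘H f = record
  { fV = λ v → fV g (fV f v)
  ; fE = λ e → fE g (fE f e)
  ; src-∘ = λ e → trans (cong (fV g) (src-∘ f e)) (src-∘ g (fE f e))
  ; tgt-∘ = λ e → trans (cong (fV g) (tgt-∘ f e)) (tgt-∘ g (fE f e))
  }

infix 4 _≈H_
_≈H_ : ∀ {A B} → Hom A B → Hom A B → Set
f ≈H g = (∀ v → fV f v ≡ fV g v) × (∀ e → fE f e ≡ fE g e)

IsMatch : ∀ {A B} → Hom A B → Set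
IsMatch f = Injective _≡_ _≡_ (fV f) × Injective _≡_ _≡_ (fE f)

IsPullback : ∀ {P X Y Z} → Hom P X → Hom P Y → Hom X Z → Hom Y Z → Set
IsPullback {P} {X} {Y} {Z} p1 p2 f g =
  (f ∘H p1 ≈H g ∘H p2) ×
  (∀ {Q} (q1 : Hom Q X) (q2 : Hom Q Y) → f ∘H q1 ≈H g ∘H q2 →
     Σ[ u ∈ Hom Q P ] ((p1 ∘H u ≈H q1) × (p2 ∘H u ≈H q2) ×
       (∀ (u' : Hom Q P) → p1 ∘H u' ≈H q1 → p2 ∘H u' ≈H q2 → u' ≈H u)))

IsPushout : ∀ {A B C D} → Hom A B → Hom A C → Hom B D → Hom C D → Set
IsPushout {A} {B} {C} {D} i1 i2 j1 j2 =
  (j1 ∘H i1 ≈H j2 ∘H i2) ×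
  (∀ {Q} (q1 : Hom B Q) (q2 : Hom C Q) → q1 ∘H i1 ≈H q2 ∘H i2 →
     Σ[ u ∈ Hom D Q ] ((u ∘H j1 ≈H q1) × (u ∘H j2 ≈H q2) ×
       (∀ (u' : Hom D Q) → u' ∘H j1 ≈H q1 → u' ∘H j2 ≈H q2 → u' ≈H u)))

-- X --g1--> W --g2--> Z is a final pullback complement of X --f1--> Y --f2--> Z.
IsFPBC : ∀ {X Y Z W} → Hom X Y → Hom Y Z → Hom X W → Hom W Z → Set
IsFPBC {X} {Y} {Z} {W} f1 f2 g1 g2 =
  IsPullback f1 g1 f2 g2 ×
  (∀ {P Q} (f1' : Hom P Y) (g1' : Hom P Q) (g2' : Hom Q Z) →
     IsPullback f1' g1' f2 g2' → (p : Hom P X) → f1 ∘H p ≈H f1' →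
     Σ[ u ∈ Hom Q W ] ((g2 ∘H u ≈H g2') × (u ∘H g1' ≈H g1 ∘H p) ×
       (∀ (u' : Hom Q W) → g2 ∘H u' ≈H g2' → u' ∘H g1' ≈H g1 ∘H p → u' ≈H u)))

record PHom (X Y : Graph) : Set where
  field
    apex     : Graph
    left     : Hom apex X
    right    : Hom apex Y
    left-mono : IsMatch left
open PHom public

idH-match : ∀ {G} → IsMatch (idH {G})
idH-match = (λ p → p) , (λ p → p)

total : ∀ {X Y} → Hom X Y → PHom X Y
total {X} f = record { apex = _ ; left = idH ; right = f ; left-mono = idH-match {X} }

-- Isomorphism of spans (equality of partial morphisms).
SpanIso : ∀ {X Y} → PHom X Y → PHom X Y → Set
SpanIso ρ ρ' =
  Σ[ φ ∈ Hom (apex ρ) (apex ρ') ] Σ[ ψ ∈ Hom (apex ρ') (apex ρ) ]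
    ((ψ ∘H φ ≈H idH) × (φ ∘H ψ ≈H idH) ×
     (left ρ' ∘H φ ≈H left ρ) × (right ρ' ∘H φ ≈H right ρ))

-- ρ is (a representative of) the composite τ ∘ σ in Grph_*:
-- computed by the pullback of right σ and left τ.
IsComposite : ∀ {X Y Z} → PHom X Y → PHom Y Z → PHom X Z → Set
IsComposite σ τ ρ =
  Σ[ P ∈ Graph ] Σ[ p1 ∈ Hom P (apex σ) ] Σ[ p2 ∈ Hom P (apex τ) ]
    (IsPullback p1 p2 (right σ) (left τ) ×
     Σ[ m ∈ IsMatch (left σ ∘H p1) ]
       SpanIso ρ (record { apex = P ; left = left σ ∘H p1
                         ; right = right τ ∘H p2 ; left-mono = m }))

CommutesP : ∀ {X Y Y' Z} → PHom X Y → PHom Y Z → PHom X Y' → PHom Y' Z → Set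
CommutesP {X} {Y} {Y'} {Z} σ τ σ' τ' =
  Σ[ ρ ∈ PHom X Z ] (IsComposite σ τ ρ × IsComposite σ' τ' ρ)

record Rule (L R : Graph) : Set where
  field
    K      : Graph
    r₁     : Hom K L
    r₂     : Hom K R
    r₁-match : IsMatch r₁
    r₂-match : IsMatch r₂
open Rule public

_† : ∀ {L R} → Rule L R → Rule R L
α † = record { K = K α ; r₁ = r₂ α ; r₂ = r₁ α
             ; r₁-match = r₂-match α ; r₂-match = r₁-match α }

rule→P : ∀ {L R} → Rule L R → PHom L R
rule→P α = record { apex = K α ; left = r₁ α ; right = r₂ α ; left-mono = r₁-match α }

Derivation : ∀ {L R G H} → Rule L R → Hom L G → Hom R H → Rule G H → Set
Derivation α f g β =
  Σ[ h ∈ Hom (K α) (K β) ]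
    (IsMatch h ×
     IsFPBC (r₁ α) f h (r₁ β) ×
     IsPushout (r₂ α) h g (r₂ β) ×
     IsMatch g)

-- Every square involved is analysed elementwise, on nodes and on edges separately: a pullback
-- square covers every compatible pair of elements, a square of matches is a pushout exactly when
-- it is jointly surjective and covers compatible pairs, and an FPBC of matches contains every
-- element of the host graph that is not deleted, i.e. all of whose preimages lie in the interface.
--
-- The middle interface map m : K γ → K β is g₂ ∘ r₂ γ factored through r₂ β, and f₂ is induced by
-- f and r₁ β ∘ m on the pushout S.  Stacking the squares of f₁ ⇒ g₁ on top of those of f₂ ⇒ g₂
-- gives back the given derivation of f, and each lower square inherits its pullback or pushout
-- property from the outer rectangle and the joint surjectivity of the square above it.  The one
-- non-formal point is that the upper right square is a pushout, i.e. that T is covered by g₁ and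
-- r₂ γ: this is the dangling condition, inherited from the pushout H.

module Submission where

open import Defs
open import Data.Bool using (if_then_else_)
open import Data.Fin using (Fin; zero; suc; combine; remQuot)
open import Data.Fin.Properties using (_≟_; any?; all?; remQuot-combine; 0≢1+n)
open import Data.List using (List; _∷_; filter; length; lookup; allFin)
open import Data.List.Membership.Propositional.Properties
  using (∈-filter⁺; ∈-filter⁻; ∈-allFin; ∈-lookup)
open import Data.List.Relation.Unary.All as All using ()
open import Data.List.Relation.Unary.Any using (index)
open import Data.List.Relation.Unary.Any.Properties using (lookup-index)
open import Data.List.Relation.Unary.AllPairs using (_∷_)
open import Data.List.Relation.Unary.Unique.Propositional using (Unique)
open import Data.List.Relation.Unary.Unique.Propositional.Properties using (filter⁺; allFin⁺)
open import Data.Nat using (ℕ; _*_)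
open import Data.Product using (Σ-syntax; _×_; _,_; proj₁; proj₂)
open import Data.Sum using (_⊎_; inj₁; inj₂)
open import Function using (Injective)
open import Relation.Nullary using (¬_; yes; no; does; contradiction)
open import Relation.Nullary.Decidable using (_→-dec_; _×-dec_; dec-true; dec-false)
open import Relation.Unary using (Decidable)
open import Relation.Binary using (Setoid)
import Relation.Binary.Reasoning.Setoid as Reasoning
open import Level using (0ℓ)
open import Relation.Binary.PropositionalEquality

Image : {U V : Set} → (U → V) → V → Set
Image {U} f y = Σ[ x ∈ U ] f x ≡ y

image? : ∀ {m n} (f : Fin m → Fin n) → Decidable (Image f)
image? f y = any? (λ x → f x ≟ y)

JointlySurjective : {U V W : Set} → (U → W) → (V → W) → Set
JointlySurjective j₁ j₂ = ∀ z → Image j₁ z ⊎ Image j₂ z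

CoversPullback : {U V W Z : Set} → (U → V) → (U → W) → (V → Z) → (W → Z) → Set
CoversPullback {U} p₁ p₂ f g = ∀ x y → f x ≡ g y → Σ[ w ∈ U ] (p₁ w ≡ x × p₂ w ≡ y)

Preserved : {U V W : Set} → (V → W) → (U → V) → W → Set
Preserved f a y = ∀ x → f x ≡ y → Image a x

preserved? : ∀ {l m n} (f : Fin m → Fin n) (a : Fin l → Fin m) → Decidable (Preserved f a)
preserved? f a y = all? (λ x → (f x ≟ y) →-dec image? a x)

module _ {U V W : Set} {j₁ : U → W} {j₂ : V → W} where

  jointlySurjective⇒epic : JointlySurjective j₁ j₂ → {Z : Set} {u v : W → Z} →
    (∀ x → u (j₁ x) ≡ v (j₁ x)) → (∀ y → u (j₂ y) ≡ v (j₂ y)) → ∀ z → u z ≡ v z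
  jointlySurjective⇒epic js eq₁ eq₂ z with js z
  ... | inj₁ (x , refl) = eq₁ x
  ... | inj₂ (y , refl) = eq₂ y

  jointlySurjective⇒injective : JointlySurjective j₁ j₂ → {Z : Set} {u : W → Z} →
    Injective _≡_ _≡_ (λ x → u (j₁ x)) → Injective _≡_ _≡_ (λ y → u (j₂ y)) →
    (∀ x y → u (j₁ x) ≡ u (j₂ y) → j₁ x ≡ j₂ y) → Injective _≡_ _≡_ u
  jointlySurjective⇒injective js u∘j₁-injective u∘j₂-injective cross {z} {z'} eq with js z | js z'
  ... | inj₁ (x , refl) | inj₁ (x' , refl) = cong j₁ (u∘j₁-injective eq)
  ... | inj₁ (x , refl) | inj₂ (y , refl) = cross x y eq
  ... | inj₂ (y , refl) | inj₁ (x , refl) = sym (cross x y (sym eq))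
  ... | inj₂ (y , refl) | inj₂ (y' , refl) = cong j₂ (u∘j₂-injective eq)

  module Copairing {A : Set} {i₁ : A → U} {i₂ : A → V}
    (j₁-injective : Injective _≡_ _≡_ j₁) (j₂-injective : Injective _≡_ _≡_ j₂)
    (js : JointlySurjective j₁ j₂) (covers : CoversPullback i₁ i₂ j₁ j₂)
    {Z : Set} {q₁ : U → Z} {q₂ : V → Z} (cocone : ∀ a → q₁ (i₁ a) ≡ q₂ (i₂ a)) where

    copair : W → Z
    copair z with js z
    ... | inj₁ (x , _) = q₁ x
    ... | inj₂ (y , _) = q₂ y

    copair-β₁ : ∀ x → copair (j₁ x) ≡ q₁ x
    copair-β₁ x with js (j₁ x)
    ... | inj₁ (x' , eq) = cong q₁ (j₁-injective eq)
    ... | inj₂ (y , eq) with covers x y (sym eq)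
    ...   | a , refl , refl = sym (cocone a)

    copair-β₂ : ∀ y → copair (j₂ y) ≡ q₂ y
    copair-β₂ y with js (j₂ y)
    ... | inj₂ (y' , eq) = cong q₂ (j₂-injective eq)
    ... | inj₁ (x , eq) with covers x y eq
    ...   | a , refl , refl = cocone a

jointlySurjective-∘ˡ : {U V W Z : Set} {j : U → V} {q : V → Z} {b : W → Z} →
  JointlySurjective (λ x → q (j x)) b → JointlySurjective q b
jointlySurjective-∘ˡ {j = j} js z with js z
... | inj₁ (x , eq) = inj₁ (j x , eq)
... | inj₂ im = inj₂ im

preserved-image : {U V W : Set} {f : V → W} {a : U → V} →
  Injective _≡_ _≡_ f → ∀ w → Preserved f a (f (a w))
preserved-image f-injective w x eq = w , sym (f-injective eq)

preserved-covers : {U V W Z : Set} {a : U → V} {g : U → W} {f : V → Z} {i : W → Z} →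
  Injective _≡_ _≡_ i → (∀ w → i (g w) ≡ f (a w)) → (∀ z → Preserved f a (i z)) →
  CoversPullback a g f i
preserved-covers i-injective square preserved x z eq with preserved z x eq
... | w , refl = w , refl , i-injective (trans (square w) eq)

--  Ka ─a→ X
--  ↓k     ↓j
--  Kc ─c→ Y      with outer rectangle  Ka ─a→ X ─o→ Z  and  Ka ─h→ Kb ─b→ Z
--  ↓m     ↓q
--  Kb ─b→ Z
module _ {Ka X Kc Y Kb Z : Set}
  {a : Ka → X} {k : Ka → Kc} {j : X → Y} {c : Kc → Y} {q : Y → Z} {b : Kb → Z} where

  lower-corner-in-image : {h : Ka → Kb} →
    JointlySurjective (λ x → q (j x)) b → Injective _≡_ _≡_ q → CoversPullback a k j c →
    (∀ w → q (j (a w)) ≡ b (h w)) → ∀ v → Image b (q (c v))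
  lower-corner-in-image {h} js q-injective covers outer v with js (q (c v))
  ... | inj₂ im = im
  ... | inj₁ (x , eq) with covers x v (q-injective eq)
  ...   | w , refl , refl = h w , trans (sym (outer w)) eq

  module StackedSquares {m : Kc → Kb} {h : Ka → Kb} {o : X → Z}
    (upper : ∀ w → j (a w) ≡ c (k w)) (lower : ∀ v → q (c v) ≡ b (m v))
    (left : ∀ w → m (k w) ≡ h w) (right : ∀ x → q (j x) ≡ o x)
    (outer : CoversPullback a h o b) (b-injective : Injective _≡_ _≡_ b)
    (js : JointlySurjective j c) where

    lower-covers : CoversPullback c m q b
    lower-covers y z eq with js y
    ... | inj₂ (v , refl) = v , refl , b-injective (trans (sym (lower v)) eq)
    ... | inj₁ (x , refl) with outer x z (trans (sym (right x)) eq)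
    ...   | w , refl , refl = k w , sym (upper w) , left w

    lower-injective : Injective _≡_ _≡_ o → Injective _≡_ _≡_ m → Injective _≡_ _≡_ q
    lower-injective o-injective m-injective = jointlySurjective⇒injective js
      (λ eq → o-injective (trans (sym (right _)) (trans eq (right _))))
      (λ eq → m-injective (b-injective (trans (sym (lower _)) (trans eq (lower _)))))
      cross
      where
      cross : ∀ x v → q (j x) ≡ q (c v) → j x ≡ c v
      cross x v eq with outer x (m v) (trans (sym (right x)) (trans eq (lower v)))
      ... | w , refl , hw≡mv = trans (upper w) (cong c (m-injective (trans (left w) hw≡mv)))

preserved-under-pullback : {Ka X Kc Y Z P Q : Set} {a : Ka → X} {k : Ka → Kc} {j : X → Y} {c : Kc → Y}
  {q : Y → Z} {o : X → Z} {f' : P → Y} {g' : P → Q} {k' : Q → Z} {p : P → Kc} →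
  CoversPullback a k j c → (∀ x → q (j x) ≡ o x) →
  CoversPullback f' g' q k' → (∀ w → c (p w) ≡ f' w) → ∀ y → Preserved o a (k' y)
preserved-under-pullback {j = j} {p = p} upper right test c∘p y x eq
  with test (j x) y (trans (right x) eq)
... | w , f'w≡jx , _ with upper x (p w) (trans (sym f'w≡jx) (sym (c∘p w)))
...   | a' , a'↦x , _ = a' , a'↦x

preserved-if-below : {Ka X Y Kb Z : Set}
  {a : Ka → X} {h : Ka → Kb} {j : X → Y} {q : Y → Z} {b : Kb → Z} →
  CoversPullback a h (λ x → q (j x)) b → ∀ s → Image b (q s) → Preserved j a s
preserved-if-below {q = q} covers s (z , bz≡qs) x jx≡s
  with covers x z (trans (cong q jx≡s) (sym bz≡qs))
... | w , aw≡x , _ = w , aw≡x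

pulled-back-lands : {A X Y Kb P Q : Set} {a : A → X} {h : A → Kb} {f : X → Y} {b : Kb → Y}
  {f' : P → X} {g' : P → Q} {k' : Q → Y} {p : P → A} →
  JointlySurjective f b → (∀ w → f (a w) ≡ b (h w)) →
  CoversPullback f' g' f k' → (∀ w → a (p w) ≡ f' w) → ∀ y → Image b (k' y)
pulled-back-lands {h = h} {f = f} {k' = k'} {p = p} js square test a∘p y with js (k' y)
... | inj₂ im = im
... | inj₁ (x , fx≡k'y) with test x y fx≡k'y
...   | w , refl , _ = h (p w) , trans (sym (square (p w))) (trans (cong f (a∘p w)) fx≡k'y)

private variable
  A B C D P Q W X Y Z : Graph

≈H-refl : {f : Hom A B} → f ≈H f
≈H-refl = (λ _ → refl) , (λ _ → refl)

≈H-sym : {f g : Hom A B} → f ≈H g → g ≈H f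
≈H-sym (eqV , eqE) = (λ v → sym (eqV v)) , (λ e → sym (eqE e))

≈H-trans : {f g h : Hom A B} → f ≈H g → g ≈H h → f ≈H h
≈H-trans (eqV , eqE) (eqV' , eqE') = (λ v → trans (eqV v) (eqV' v)) , (λ e → trans (eqE e) (eqE' e))

Hom-setoid : Graph → Graph → Setoid 0ℓ 0ℓ
Hom-setoid A B = record
  { Carrier = Hom A B ; _≈_ = _≈H_
  ; isEquivalence = record
      { refl = λ {f} → ≈H-refl {f = f}
      ; sym = λ {f} {g} → ≈H-sym {f = f} {g}
      ; trans = λ {f} {g} {h} → ≈H-trans {f = f} {g} {h} } }

∘-congˡ : (h : Hom B C) {f g : Hom A B} → f ≈H g → h ∘H f ≈H h ∘H g
∘-congˡ h (eqV , eqE) = (λ v → cong (fV h) (eqV v)) , (λ e → cong (fE h) (eqE e))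

∘-congʳ : (h : Hom A B) {f g : Hom B C} → f ≈H g → f ∘H h ≈H g ∘H h
∘-congʳ h (eqV , eqE) = (λ v → eqV (fV h v)) , (λ e → eqE (fE h e))

match-cancelˡ : (j : Hom B C) → IsMatch j → (u v : Hom A B) → j ∘H u ≈H j ∘H v → u ≈H v
match-cancelˡ _ (jV , jE) _ _ (eqV , eqE) = (λ x → jV (eqV x)) , (λ e → jE (eqE e))

∘-match : (g : Hom B C) (f : Hom A B) → IsMatch g → IsMatch f → IsMatch (g ∘H f)
∘-match _ _ (g-injV , g-injE) (f-injV , f-injE) =
  (λ eq → f-injV (g-injV eq)) , (λ eq → f-injE (g-injE eq))

match-of-factor : (j : Hom B C) (u : Hom A B) {φ : Hom A C} → j ∘H u ≈H φ → IsMatch φ → IsMatch u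
match-of-factor j _ (eqV , eqE) (φV , φE) =
  (λ eq → φV (trans (sym (eqV _)) (trans (cong (fV j) eq) (eqV _)))) ,
  (λ eq → φE (trans (sym (eqE _)) (trans (cong (fE j) eq) (eqE _))))

data Endpoint : Set where
  source target : Endpoint

end : Endpoint → (G : Graph) → Fin (nE G) → Fin (nV G)
end source = src
end target = tgt

end-∘ : (f : Hom A B) (ε : Endpoint) (e : Fin (nE A)) → fV f (end ε A e) ≡ end ε B (fE f e)
end-∘ f source = src-∘ f
end-∘ f target = tgt-∘ f

homFromEnds : (φV : Fin (nV A) → Fin (nV B)) (φE : Fin (nE A) → Fin (nE B)) →
  (∀ ε e → φV (end ε A e) ≡ end ε B (φE e)) → Hom A B
homFromEnds φV φE φ-end =
  record { fV = φV ; fE = φE ; src-∘ = φ-end source ; tgt-∘ = φ-end target }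

LandsIn : Hom A C → Hom B C → Set
LandsIn φ j = (∀ x → Image (fV j) (fV φ x)) × (∀ e → Image (fE j) (fE φ e))

factor-through-match : (j : Hom B C) → IsMatch j → (φ : Hom A C) → LandsIn φ j →
  Σ[ u ∈ Hom A B ] j ∘H u ≈H φ
factor-through-match {B} {C} {A} j (jV , _) φ (landsV , landsE) =
  homFromEnds (λ x → proj₁ (landsV x)) (λ e → proj₁ (landsE e)) u-end ,
  (λ x → proj₂ (landsV x)) , (λ e → proj₂ (landsE e))
  where
  u-end : ∀ ε e → proj₁ (landsV (end ε A e)) ≡ end ε B (proj₁ (landsE e))
  u-end ε e = jV (begin
    fV j (proj₁ (landsV (end ε A e)))  ≡⟨ proj₂ (landsV _) ⟩
    fV φ (end ε A e)                   ≡⟨ end-∘ φ ε e ⟩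
    end ε C (fE φ e)                   ≡⟨ cong (end ε C) (sym (proj₂ (landsE e))) ⟩
    end ε C (fE j (proj₁ (landsE e)))  ≡⟨ sym (end-∘ j ε _) ⟩
    fV j (end ε B (proj₁ (landsE e)))  ∎)
    where open ≡-Reasoning

Point : Graph
Point = record { nV = 1 ; nE = 0 ; src = λ () ; tgt = λ () }

point : Fin (nV X) → Hom Point X
point x = record { fV = λ _ → x ; fE = λ () ; src-∘ = λ () ; tgt-∘ = λ () }

Arrow : Graph
Arrow = record { nV = 2 ; nE = 1 ; src = λ _ → zero ; tgt = λ _ → suc zero }

arrow : Fin (nE X) → Hom Arrow X
arrow {X} e = record
  { fV = λ { zero → src X e ; (suc zero) → tgt X e } ; fE = λ _ → e
  ; src-∘ = λ _ → refl ; tgt-∘ = λ _ → refl }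

CoversPullbackᴳ : Hom P X → Hom P Y → Hom X Z → Hom Y Z → Set
CoversPullbackᴳ p₁ p₂ f g =
  CoversPullback (fV p₁) (fV p₂) (fV f) (fV g) × CoversPullback (fE p₁) (fE p₂) (fE f) (fE g)

JointlySurjectiveᴳ : Hom B D → Hom C D → Set
JointlySurjectiveᴳ j₁ j₂ =
  JointlySurjective (fV j₁) (fV j₂) × JointlySurjective (fE j₁) (fE j₂)

isPullback⇒covers : (p₁ : Hom P X) (p₂ : Hom P Y) (f : Hom X Z) (g : Hom Y Z) →
  IsPullback p₁ p₂ f g → CoversPullbackᴳ p₁ p₂ f g
isPullback⇒covers {X = X} {Y = Y} {Z = Z} p₁ p₂ f g (_ , universal) = nodes , edges
  where
  nodes : CoversPullback (fV p₁) (fV p₂) (fV f) (fV g)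
  nodes x y eq with universal (point x) (point y) ((λ _ → eq) , λ ())
  ... | u , (p₁u , _) , (p₂u , _) , _ = fV u zero , p₁u zero , p₂u zero

  edges : CoversPullback (fE p₁) (fE p₂) (fE f) (fE g)
  edges x y eq with universal (arrow x) (arrow y) (endpoints , λ _ → eq)
    where
    endpoint : ∀ ε → fV f (end ε X x) ≡ fV g (end ε Y y)
    endpoint ε = trans (end-∘ f ε x) (trans (cong (end ε Z) eq) (sym (end-∘ g ε y)))
    endpoints : ∀ v → fV f (fV (arrow x) v) ≡ fV g (fV (arrow y) v)
    endpoints zero = endpoint source
    endpoints (suc zero) = endpoint target
  ... | u , (_ , p₁u) , (_ , p₂u) , _ = fE u zero , p₁u zero , p₂u zero

covers⇒isPullback : (p₁ : Hom P X) (p₂ : Hom P Y) (f : Hom X Z) (g : Hom Y Z) →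
  f ∘H p₁ ≈H g ∘H p₂ → IsMatch p₁ → CoversPullbackᴳ p₁ p₂ f g → IsPullback p₁ p₂ f g
covers⇒isPullback {P = P} {X = X} {Y = Y} p₁ p₂ f g square p₁-match (coversV , coversE) =
  square , universal
  where
  universal : ∀ {Q} (q₁ : Hom Q X) (q₂ : Hom Q Y) → f ∘H q₁ ≈H g ∘H q₂ →
    Σ[ u ∈ Hom Q P ] ((p₁ ∘H u ≈H q₁) × (p₂ ∘H u ≈H q₂) ×
      (∀ (u' : Hom Q P) → p₁ ∘H u' ≈H q₁ → p₂ ∘H u' ≈H q₂ → u' ≈H u))
  universal {Q} q₁ q₂ (eqV , eqE) =
    u , p₁∘u≈q₁ ,
    -- u is assembled from the covering witnesses, so its second leg commutes by construction.
    ((λ v → proj₂ (proj₂ (coversV _ _ (eqV v)))) ,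
     (λ e → proj₂ (proj₂ (coversE _ _ (eqE e))))) ,
    λ u' p₁∘u'≈q₁ _ → match-cancelˡ p₁ p₁-match u' u (begin
      p₁ ∘H u' ≈⟨ p₁∘u'≈q₁ ⟩
      q₁       ≈⟨ p₁∘u≈q₁ ⟨
      p₁ ∘H u  ∎)
    where
    lands : LandsIn q₁ p₁
    lands = (λ v → let (w , p₁w , _) = coversV _ _ (eqV v) in w , p₁w)
          , (λ e → let (w , p₁w , _) = coversE _ _ (eqE e) in w , p₁w)
    factored = factor-through-match p₁ p₁-match q₁ lands
    u = proj₁ factored
    p₁∘u≈q₁ = proj₂ factored
    open Reasoning (Hom-setoid Q X)

isPullback-id : (j : Hom A B) → IsPullback idH j j idH
isPullback-id {A} j = covers⇒isPullback idH j j idH (≈H-refl {f = j}) (idH-match {A})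
  ((λ x _ eq → x , refl , eq) , (λ x _ eq → x , refl , eq))

-- Morphisms into Complete n and Bouquet n are arbitrary colourings of the nodes, resp. edges.
-- Testing a pushout against two colourings that differ at a single element decides whether that
-- element is reached by either leg.
Complete : ℕ → Graph
Complete n = record
  { nV = n ; nE = n * n
  ; src = λ e → proj₁ (remQuot {n} n e) ; tgt = λ e → proj₂ (remQuot {n} n e) }

classifyNodes : ∀ {n} → (Fin (nV A) → Fin n) → Hom A (Complete n)
classifyNodes {A} χ = record
  { fV = χ ; fE = λ e → combine (χ (src A e)) (χ (tgt A e))
  ; src-∘ = λ e → sym (cong proj₁ (remQuot-combine (χ (src A e)) (χ (tgt A e))))
  ; tgt-∘ = λ e → sym (cong proj₂ (remQuot-combine (χ (src A e)) (χ (tgt A e)))) }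

classifyNodes-∘ : ∀ {n} (χ : Fin (nV B) → Fin n) (j : Hom A B) (χ' : Fin (nV A) → Fin n) →
  (∀ x → χ (fV j x) ≡ χ' x) → classifyNodes χ ∘H j ≈H classifyNodes χ'
classifyNodes-∘ {B} {A} χ j χ' eq = eq , λ e → cong₂ combine (endpoint source e) (endpoint target e)
  where
  endpoint : ∀ ε e → χ (end ε B (fE j e)) ≡ χ' (end ε A e)
  endpoint ε e = trans (cong χ (sym (end-∘ j ε e))) (eq (end ε A e))

Bouquet : ℕ → Graph
Bouquet n = record { nV = 1 ; nE = n ; src = λ _ → zero ; tgt = λ _ → zero }

classifyEdges : ∀ {n} → (Fin (nE A) → Fin n) → Hom A (Bouquet n)
classifyEdges ψ = record { fV = λ _ → zero ; fE = ψ ; src-∘ = λ _ → refl ; tgt-∘ = λ _ → refl }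

classifyEdges-∘ : ∀ {n} (ψ : Fin (nE B) → Fin n) (j : Hom A B) (ψ' : Fin (nE A) → Fin n) →
  (∀ x → ψ (fE j x) ≡ ψ' x) → classifyEdges ψ ∘H j ≈H classifyEdges ψ'
classifyEdges-∘ ψ j ψ' eq = (λ _ → refl) , eq

indicator : ∀ {n} → Fin n → Fin n → Fin 2
indicator y x = if does (x ≟ y) then suc zero else zero

indicator-self : ∀ {n} (y : Fin n) → indicator y y ≡ suc zero
indicator-self y = cong (λ b → if b then suc zero else zero) (dec-true (y ≟ y) refl)

indicator-other : ∀ {n} {x y : Fin n} → x ≢ y → indicator y x ≡ zero
indicator-other {x = x} {y} x≢y = cong (λ b → if b then suc zero else zero) (dec-false (x ≟ y) x≢y)

module _ (i₁ : Hom A B) (i₂ : Hom A C) (j₁ : Hom B D) (j₂ : Hom C D)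
  (pushout : IsPushout i₁ i₂ j₁ j₂) where

  isPushout⇒jointlyEpic : (u u' : Hom D Q) →
    u' ∘H j₁ ≈H u ∘H j₁ → u' ∘H j₂ ≈H u ∘H j₂ → u' ≈H u
  isPushout⇒jointlyEpic {Q} u u' u'≈u₁ u'≈u₂
    with proj₂ pushout (u ∘H j₁) (u ∘H j₂) (∘-congˡ u {j₁ ∘H i₁} {j₂ ∘H i₂} (proj₁ pushout))
  ... | v , _ , _ , unique = begin
    u' ≈⟨ unique u' u'≈u₁ u'≈u₂ ⟩
    v  ≈⟨ unique u (≈H-refl {f = u ∘H j₁}) (≈H-refl {f = u ∘H j₂}) ⟨
    u  ∎
    where open Reasoning (Hom-setoid D Q)

  isPushout⇒jointlySurjective : JointlySurjectiveᴳ j₁ j₂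
  isPushout⇒jointlySurjective = nodes , edges
    where
    nodes : JointlySurjective (fV j₁) (fV j₂)
    nodes d with image? (fV j₁) d | image? (fV j₂) d
    ... | yes im | _ = inj₁ im
    ... | no _ | yes im = inj₂ im
    ... | no ∉₁ | no ∉₂ =
      contradiction (trans (sym (proj₁ indicator≈zero d)) (indicator-self d)) 0≢1+n
      where
      vanishes : (j : Hom X D) → ¬ Image (fV j) d →
        classifyNodes (indicator d) ∘H j ≈H classifyNodes (λ _ → zero)
      vanishes j ∉ =
        classifyNodes-∘ (indicator d) j (λ _ → zero) (λ x → indicator-other (λ eq → ∉ (x , eq)))
      indicator≈zero = isPushout⇒jointlyEpic (classifyNodes (λ _ → zero)) (classifyNodes (indicator d))
        (vanishes j₁ ∉₁) (vanishes j₂ ∉₂)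

    edges : JointlySurjective (fE j₁) (fE j₂)
    edges d with image? (fE j₁) d | image? (fE j₂) d
    ... | yes im | _ = inj₁ im
    ... | no _ | yes im = inj₂ im
    ... | no ∉₁ | no ∉₂ =
      contradiction (trans (sym (proj₂ indicator≈zero d)) (indicator-self d)) 0≢1+n
      where
      vanishes : (j : Hom X D) → ¬ Image (fE j) d →
        classifyEdges (indicator d) ∘H j ≈H classifyEdges (λ _ → zero)
      vanishes j ∉ =
        classifyEdges-∘ (indicator d) j (λ _ → zero) (λ x → indicator-other (λ eq → ∉ (x , eq)))
      indicator≈zero = isPushout⇒jointlyEpic (classifyEdges (λ _ → zero)) (classifyEdges (indicator d))
        (vanishes j₁ ∉₁) (vanishes j₂ ∉₂)

  isPushout⇒covers : IsMatch j₂ → CoversPullbackᴳ i₁ i₂ j₁ j₂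
  isPushout⇒covers (j₂V , j₂E) = nodes , edges
    where
    nodes : CoversPullback (fV i₁) (fV i₂) (fV j₁) (fV j₂)
    nodes x y eq with image? (fV i₁) x
    ... | yes (a , refl) = a , refl , j₂V (trans (sym (proj₁ (proj₁ pushout) a)) eq)
    ... | no ∉ with proj₂ pushout (classifyNodes (indicator x)) (classifyNodes (λ _ → zero))
                  (classifyNodes-∘ (indicator x) i₁ (λ _ → zero)
                    (λ a → indicator-other (λ eq → ∉ (a , eq))))
    ...   | u , (u∘j₁ , _) , (u∘j₂ , _) , _ =
      contradiction (trans (sym (u∘j₂ y)) (trans (cong (fV u) (sym eq)) (trans (u∘j₁ x) (indicator-self x))))
        0≢1+n

    edges : CoversPullback (fE i₁) (fE i₂) (fE j₁) (fE j₂)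
    edges x y eq with image? (fE i₁) x
    ... | yes (a , refl) = a , refl , j₂E (trans (sym (proj₂ (proj₁ pushout) a)) eq)
    ... | no ∉ with proj₂ pushout (classifyEdges (indicator x)) (classifyEdges (λ _ → zero))
                  (classifyEdges-∘ (indicator x) i₁ (λ _ → zero)
                    (λ a → indicator-other (λ eq → ∉ (a , eq))))
    ...   | u , (_ , u∘j₁) , (_ , u∘j₂) , _ =
      contradiction (trans (sym (u∘j₂ y)) (trans (cong (fE u) (sym eq)) (trans (u∘j₁ x) (indicator-self x))))
        0≢1+n

respects-ends-along : (j : Hom B D) (q : Hom B Q)
  {uV : Fin (nV D) → Fin (nV Q)} {uE : Fin (nE D) → Fin (nE Q)} →
  (∀ x → uV (fV j x) ≡ fV q x) → (∀ x → uE (fE j x) ≡ fE q x) →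
  ∀ ε x → uV (end ε D (fE j x)) ≡ end ε Q (uE (fE j x))
respects-ends-along {B} {D} {Q} j q {uV} {uE} βV βE ε x = begin
  uV (end ε D (fE j x))  ≡⟨ cong uV (sym (end-∘ j ε x)) ⟩
  uV (fV j (end ε B x))  ≡⟨ βV (end ε B x) ⟩
  fV q (end ε B x)       ≡⟨ end-∘ q ε x ⟩
  end ε Q (fE q x)       ≡⟨ cong (end ε Q) (sym (βE x)) ⟩
  end ε Q (uE (fE j x))  ∎
  where open ≡-Reasoning

covers⇒isPushout : (i₁ : Hom A B) (i₂ : Hom A C) (j₁ : Hom B D) (j₂ : Hom C D) →
  j₁ ∘H i₁ ≈H j₂ ∘H i₂ → IsMatch j₁ → IsMatch j₂ → JointlySurjectiveᴳ j₁ j₂ →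
  CoversPullbackᴳ i₁ i₂ j₁ j₂ → IsPushout i₁ i₂ j₁ j₂
covers⇒isPushout {B = B} {C = C} {D = D} i₁ i₂ j₁ j₂ square
  (j₁V , j₁E) (j₂V , j₂E) (jsV , jsE) (coversV , coversE) =
  square , universal
  where
  universal : ∀ {Q} (q₁ : Hom B Q) (q₂ : Hom C Q) → q₁ ∘H i₁ ≈H q₂ ∘H i₂ →
    Σ[ u ∈ Hom D Q ] ((u ∘H j₁ ≈H q₁) × (u ∘H j₂ ≈H q₂) ×
      (∀ (u' : Hom D Q) → u' ∘H j₁ ≈H q₁ → u' ∘H j₂ ≈H q₂ → u' ≈H u))
  universal {Q} q₁ q₂ (coconeV , coconeE) =
    u , (V.copair-β₁ , E.copair-β₁) , (V.copair-β₂ , E.copair-β₂) , unique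
    where
    module V = Copairing j₁V j₂V jsV coversV {q₁ = fV q₁} {fV q₂} coconeV
    module E = Copairing j₁E j₂E jsE coversE {q₁ = fE q₁} {fE q₂} coconeE

    u-end : ∀ ε e → Image (fE j₁) e ⊎ Image (fE j₂) e → V.copair (end ε D e) ≡ end ε Q (E.copair e)
    u-end ε _ (inj₁ (x , refl)) =
      respects-ends-along j₁ q₁ {V.copair} {E.copair} V.copair-β₁ E.copair-β₁ ε x
    u-end ε _ (inj₂ (y , refl)) =
      respects-ends-along j₂ q₂ {V.copair} {E.copair} V.copair-β₂ E.copair-β₂ ε y

    u : Hom D Q
    u = homFromEnds V.copair E.copair (λ ε e → u-end ε e (jsE e))

    unique : ∀ (u' : Hom D Q) → u' ∘H j₁ ≈H q₁ → u' ∘H j₂ ≈H q₂ → u' ≈H u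
    unique u' (u'∘j₁V , u'∘j₁E) (u'∘j₂V , u'∘j₂E) =
      jointlySurjective⇒epic jsV (λ x → trans (u'∘j₁V x) (sym (V.copair-β₁ x)))
                                 (λ y → trans (u'∘j₂V y) (sym (V.copair-β₂ y))) ,
      jointlySurjective⇒epic jsE (λ x → trans (u'∘j₁E x) (sym (E.copair-β₁ x)))
                                 (λ y → trans (u'∘j₂E y) (sym (E.copair-β₂ y)))

isFPBC-intro : (a : Hom A B) (f : Hom B C) (h : Hom A D) (b : Hom D C) →
  IsPullback a h f b → IsMatch b →
  (∀ {P Q} (f' : Hom P B) (g' : Hom P Q) (k' : Hom Q C) → IsPullback f' g' f k' →
     (p : Hom P A) → a ∘H p ≈H f' → LandsIn k' b) →
  IsFPBC a f h b
isFPBC-intro {A = A} {B = B} {C = C} {D = D} a f h b pullback b-match lands = pullback , universal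
  where
  universal : ∀ {P Q} (f' : Hom P B) (g' : Hom P Q) (k' : Hom Q C) → IsPullback f' g' f k' →
    (p : Hom P A) → a ∘H p ≈H f' →
    Σ[ u ∈ Hom Q D ] ((b ∘H u ≈H k') × (u ∘H g' ≈H h ∘H p) ×
      (∀ (u' : Hom Q D) → b ∘H u' ≈H k' → u' ∘H g' ≈H h ∘H p → u' ≈H u))
  universal {P} {Q} f' g' k' test p a∘p≈f' = u , b∘u≈k' , u∘g'≈h∘p , unique
    where
    factored = factor-through-match b b-match k' (lands f' g' k' test p a∘p≈f')
    u = proj₁ factored
    b∘u≈k' = proj₂ factored

    u∘g'≈h∘p : u ∘H g' ≈H h ∘H p
    u∘g'≈h∘p = match-cancelˡ b b-match (u ∘H g') (h ∘H p) (begin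
      b ∘H u ∘H g'  ≈⟨ ∘-congʳ g' {b ∘H u} {k'} b∘u≈k' ⟩
      k' ∘H g'      ≈⟨ proj₁ test ⟨
      f ∘H f'       ≈⟨ ∘-congˡ f {a ∘H p} {f'} a∘p≈f' ⟨
      f ∘H a ∘H p   ≈⟨ ∘-congʳ p {f ∘H a} {b ∘H h} (proj₁ pullback) ⟩
      b ∘H h ∘H p   ∎)
      where open Reasoning (Hom-setoid P C)

    unique : ∀ (u' : Hom Q D) → b ∘H u' ≈H k' → u' ∘H g' ≈H h ∘H p → u' ≈H u
    unique u' b∘u'≈k' _ = match-cancelˡ b b-match u' u (begin
      b ∘H u' ≈⟨ b∘u'≈k' ⟩
      k'      ≈⟨ b∘u≈k' ⟨
      b ∘H u  ∎)
      where open Reasoning (Hom-setoid Q C)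

isPushout⇒isFPBC : (a : Hom A B) (h : Hom A D) (f : Hom B C) (b : Hom D C) →
  IsPushout a h f b → IsMatch a → IsMatch b → IsFPBC a f h b
isPushout⇒isFPBC a h f b pushout a-match b-match = isFPBC-intro a f h b pullback b-match lands
  where
  pullback : IsPullback a h f b
  pullback = covers⇒isPullback a h f b (proj₁ pushout) a-match
    (isPushout⇒covers a h f b pushout b-match)

  lands : ∀ {P Q} (f' : Hom P _) (g' : Hom P Q) (k' : Hom Q _) → IsPullback f' g' f k' →
    (p : Hom P _) → a ∘H p ≈H f' → LandsIn k' b
  lands f' g' k' test p (a∘pV , a∘pE) =
    pulled-back-lands {h = fV h} {p = fV p} (proj₁ js) (proj₁ (proj₁ pushout)) (proj₁ covers) a∘pV ,
    pulled-back-lands {h = fE h} {p = fE p} (proj₂ js) (proj₂ (proj₁ pushout)) (proj₂ covers) a∘pE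
    where
    js = isPushout⇒jointlySurjective a h f b pushout
    covers = isPullback⇒covers f' g' f k' test

lookup-injective : {U : Set} {xs : List U} → Unique xs → Injective _≡_ _≡_ (lookup xs)
lookup-injective {xs = _ ∷ _} (_ ∷ _) {zero} {zero} _ = refl
lookup-injective {xs = _ ∷ _} (x∉ ∷ _) {zero} {suc j} eq =
  contradiction eq (All.lookup x∉ (∈-lookup j))
lookup-injective {xs = _ ∷ _} (x∉ ∷ _) {suc i} {zero} eq =
  contradiction (sym eq) (All.lookup x∉ (∈-lookup i))
lookup-injective {xs = _ ∷ _} (_ ∷ unique) {suc i} {suc j} eq = cong suc (lookup-injective unique eq)

module Enumeration {n : ℕ} {Pr : Fin n → Set} (Pr? : Decidable Pr) where

  private
    elements : List (Fin n)
    elements = filter Pr? (allFin n)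

  size : ℕ
  size = length elements

  embed : Fin size → Fin n
  embed = lookup elements

  embed-injective : Injective _≡_ _≡_ embed
  embed-injective = lookup-injective (filter⁺ Pr? (allFin⁺ n))

  embed-satisfies : ∀ i → Pr (embed i)
  embed-satisfies i = proj₂ (∈-filter⁻ Pr? {xs = allFin n} (∈-lookup i))

  embed-onto : ∀ x → Pr x → Image embed x
  embed-onto x px = index x∈ , sym (lookup-index x∈)
    where x∈ = ∈-filter⁺ Pr? (∈-allFin x) px

module Subgraph (G : Graph) {Pᵥ : Fin (nV G) → Set} {Pₑ : Fin (nE G) → Set}
  (Pᵥ? : Decidable Pᵥ) (Pₑ? : Decidable Pₑ) (closed : ∀ e → Pₑ e → ∀ ε → Pᵥ (end ε G e))
  where

  module V = Enumeration Pᵥ?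
  module E = Enumeration Pₑ?

  private
    end-of : ∀ ε i → Image V.embed (end ε G (E.embed i))
    end-of ε i = V.embed-onto _ (closed _ (E.embed-satisfies i) ε)

  graph : Graph
  graph = record { nV = V.size ; nE = E.size
                 ; src = λ i → proj₁ (end-of source i) ; tgt = λ i → proj₁ (end-of target i) }

  inclusion : Hom graph G
  inclusion = record
    { fV = V.embed ; fE = E.embed
    ; src-∘ = λ i → proj₂ (end-of source i) ; tgt-∘ = λ i → proj₂ (end-of target i) }

  inclusion-match : IsMatch inclusion
  inclusion-match = V.embed-injective , E.embed-injective

PreservedEdge : Hom B C → Hom A B → Fin (nE C) → Set
PreservedEdge {C = C} f a e =
  Preserved (fE f) (fE a) e × Preserved (fV f) (fV a) (src C e) × Preserved (fV f) (fV a) (tgt C e)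

preserved-ends : (f : Hom B C) (a : Hom A B) (k' : Hom Q C) →
  (∀ y → Preserved (fV f) (fV a) (fV k' y)) →
  ∀ e → Preserved (fE f) (fE a) (fE k' e) → PreservedEdge f a (fE k' e)
preserved-ends {Q = Q} f a k' nodes e preserved = preserved , ends source , ends target
  where
  ends : ∀ ε → Preserved (fV f) (fV a) (end ε _ (fE k' e))
  ends ε = subst (Preserved (fV f) (fV a)) (end-∘ k' ε e) (nodes (end ε Q e))

isFPBC⇒preserved-in-image : (a : Hom A B) (f : Hom B C) (h : Hom A D) (b : Hom D C) →
  IsFPBC a f h b → IsMatch a → IsMatch f →
  (∀ y → Preserved (fV f) (fV a) y → Image (fV b) y) ×
  (∀ e → PreservedEdge f a e → Image (fE b) e)
isFPBC⇒preserved-in-image {C = C} a f h b fpbc a-match (f-injV , f-injE) = nodes , edges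
  where
  closed : ∀ e → PreservedEdge f a e → ∀ ε → Preserved (fV f) (fV a) (end ε C e)
  closed e (_ , s , _) source = s
  closed e (_ , _ , t) target = t

  -- The preserved elements form a subgraph whose pullback along f is A itself, so the FPBC
  -- property factors its inclusion through b.
  module Kept = Subgraph C (preserved? (fV f) (fV a))
    (λ e → preserved? (fE f) (fE a) e ×-dec
           preserved? (fV f) (fV a) (src C e) ×-dec preserved? (fV f) (fV a) (tgt C e))
    closed

  a-lands : LandsIn (f ∘H a) Kept.inclusion
  a-lands = (λ w → Kept.V.embed-onto _ (preserved-image {a = fV a} f-injV w))
          , (λ w → Kept.E.embed-onto _ (preserved-ends f a (f ∘H a) (preserved-image {a = fV a} f-injV) w
                                                       (preserved-image {a = fE a} f-injE w)))

  factored = factor-through-match Kept.inclusion Kept.inclusion-match (f ∘H a) a-lands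
  g = proj₁ factored

  pullback : IsPullback a g f Kept.inclusion
  pullback = covers⇒isPullback a g f Kept.inclusion
    (≈H-sym {f = Kept.inclusion ∘H g} {f ∘H a} (proj₂ factored)) a-match
    ( preserved-covers (proj₁ Kept.inclusion-match) (proj₁ (proj₂ factored)) Kept.V.embed-satisfies
    , preserved-covers (proj₂ Kept.inclusion-match) (proj₂ (proj₂ factored))
        (λ i → proj₁ (Kept.E.embed-satisfies i)))

  universal = proj₂ fpbc a g Kept.inclusion pullback idH (≈H-refl {f = a})
  u = proj₁ universal
  b∘u≈inclusion = proj₁ (proj₂ universal)

  nodes : ∀ y → Preserved (fV f) (fV a) y → Image (fV b) y
  nodes y preserved with Kept.V.embed-onto y preserved
  ... | z , refl = fV u z , proj₁ b∘u≈inclusion z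

  edges : ∀ e → PreservedEdge f a e → Image (fE b) e
  edges e preserved with Kept.E.embed-onto e preserved
  ... | z , refl = fE u z , proj₂ b∘u≈inclusion z

spanIso-from-legs : {Ap : Graph} (l l' : Hom Ap X) (r r' : Hom Ap Y) {m : IsMatch l} {m' : IsMatch l'} →
  l' ≈H l → r' ≈H r →
  SpanIso (record { apex = Ap ; left = l ; right = r ; left-mono = m })
          (record { apex = Ap ; left = l' ; right = r' ; left-mono = m' })
spanIso-from-legs {Ap = Ap} _ _ _ _ l'≈l r'≈r =
  idH , idH , ≈H-refl {f = idH {Ap}} , ≈H-refl {f = idH {Ap}} , l'≈l , r'≈r

commutesP-intro : (σ : PHom X Y) (τ : PHom Z W) (g : Hom Y W) (f : Hom X Z) (k : Hom (apex σ) (apex τ)) →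
  IsPullback (left σ) k f (left τ) → g ∘H right σ ≈H right τ ∘H k →
  CommutesP σ (total g) (total f) τ
commutesP-intro σ τ g f k pullback square = ρ , through-g , through-f
  where
  ρ : PHom _ _
  ρ = record { apex = apex σ ; left = left σ ; right = g ∘H right σ ; left-mono = left-mono σ }

  through-g : IsComposite σ (total g) ρ
  through-g = apex σ , idH , right σ , isPullback-id (right σ) , left-mono σ ,
    spanIso-from-legs (left σ) (left σ ∘H idH) (g ∘H right σ) (g ∘H right σ)
      {left-mono σ} {left-mono σ}
      (≈H-refl {f = left σ}) (≈H-refl {f = g ∘H right σ})

  through-f : IsComposite (total f) τ ρ
  through-f = apex σ , left σ , k , pullback , left-mono σ ,
    spanIso-from-legs (left σ) (idH ∘H left σ) (g ∘H right σ) (right τ ∘H k)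
      {left-mono σ} {left-mono σ}
      (≈H-refl {f = left σ}) (≈H-sym {f = g ∘H right σ} {right τ ∘H k} square)

module BackwardModularity {L R G H S T : Graph} (α : Rule L R) (β : Rule G H) (γ : Rule S T)
  (f : Hom L G) (f₁ : Hom L S) (g₁ : Hom R T) (g₂ : Hom T H)
  (f-match : IsMatch f) (g₁-match : IsMatch g₁) (g₂-match : IsMatch g₂)
  (h : Hom (K α) (K β)) (fpbc₁ : IsFPBC (r₁ α) f h (r₁ β))
  (pushout₁ : IsPushout (r₂ α) h (g₂ ∘H g₁) (r₂ β))
  (k : Hom (K α) (K γ)) (fpbc₂ : IsFPBC (r₂ α) g₁ k (r₂ γ))
  (pushout₂ : IsPushout (r₁ α) k f₁ (r₁ γ))
  where

  private
    covers₁ : CoversPullbackᴳ (r₁ α) h f (r₁ β)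
    covers₁ = isPullback⇒covers (r₁ α) h f (r₁ β) (proj₁ fpbc₁)

    covers₂ : CoversPullbackᴳ (r₂ α) k g₁ (r₂ γ)
    covers₂ = isPullback⇒covers (r₂ α) k g₁ (r₂ γ) (proj₁ fpbc₂)

    H-covered : JointlySurjectiveᴳ (g₂ ∘H g₁) (r₂ β)
    H-covered = isPushout⇒jointlySurjective (r₂ α) h (g₂ ∘H g₁) (r₂ β) pushout₁

    S-covered : JointlySurjectiveᴳ f₁ (r₁ γ)
    S-covered = isPushout⇒jointlySurjective (r₁ α) k f₁ (r₁ γ) pushout₂

    pushout₁-covers : CoversPullbackᴳ (r₂ α) h (g₂ ∘H g₁) (r₂ β)
    pushout₁-covers = isPushout⇒covers (r₂ α) h (g₂ ∘H g₁) (r₂ β) pushout₁ (r₂-match β)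

    pushout₂-covers : CoversPullbackᴳ (r₁ α) k f₁ (r₁ γ)
    pushout₂-covers = isPushout⇒covers (r₁ α) k f₁ (r₁ γ) pushout₂ (r₁-match γ)

    g₂∘r₂γ-lands : LandsIn (g₂ ∘H r₂ γ) (r₂ β)
    g₂∘r₂γ-lands =
      lower-corner-in-image {h = fV h} (proj₁ H-covered) (proj₁ g₂-match) (proj₁ covers₂)
        (proj₁ (proj₁ pushout₁)) ,
      lower-corner-in-image {h = fE h} (proj₂ H-covered) (proj₂ g₂-match) (proj₂ covers₂)
        (proj₂ (proj₁ pushout₁))

    factored = factor-through-match (r₂ β) (r₂-match β) (g₂ ∘H r₂ γ) g₂∘r₂γ-lands

  m : Hom (K γ) (K β)
  m = proj₁ factored

  r₂β∘m≈g₂∘r₂γ : r₂ β ∘H m ≈H g₂ ∘H r₂ γ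
  r₂β∘m≈g₂∘r₂γ = proj₂ factored

  private
    g₂∘r₂γ≈r₂β∘m : g₂ ∘H r₂ γ ≈H r₂ β ∘H m
    g₂∘r₂γ≈r₂β∘m = ≈H-sym {f = r₂ β ∘H m} {g₂ ∘H r₂ γ} r₂β∘m≈g₂∘r₂γ

  m∘k≈h : m ∘H k ≈H h
  m∘k≈h = match-cancelˡ (r₂ β) (r₂-match β) (m ∘H k) h (begin
    r₂ β ∘H m ∘H k    ≈⟨ ∘-congʳ k {r₂ β ∘H m} {g₂ ∘H r₂ γ} r₂β∘m≈g₂∘r₂γ ⟩
    g₂ ∘H r₂ γ ∘H k   ≈⟨ ∘-congˡ g₂ {g₁ ∘H r₂ α} {r₂ γ ∘H k} (proj₁ (proj₁ fpbc₂)) ⟨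
    g₂ ∘H g₁ ∘H r₂ α  ≈⟨ proj₁ pushout₁ ⟩
    r₂ β ∘H h         ∎)
    where open Reasoning (Hom-setoid (K α) H)

  m-match : IsMatch m
  m-match = match-of-factor (r₂ β) m {g₂ ∘H r₂ γ} r₂β∘m≈g₂∘r₂γ
    (∘-match g₂ (r₂ γ) g₂-match (r₂-match γ))

  private
    f∘r₁α≈r₁β∘m∘k : f ∘H r₁ α ≈H (r₁ β ∘H m) ∘H k
    f∘r₁α≈r₁β∘m∘k = begin
      f ∘H r₁ α       ≈⟨ proj₁ (proj₁ fpbc₁) ⟩
      r₁ β ∘H h       ≈⟨ ∘-congˡ (r₁ β) {m ∘H k} {h} m∘k≈h ⟨
      r₁ β ∘H m ∘H k  ∎
      where open Reasoning (Hom-setoid (K α) G)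

    mediating = proj₂ pushout₂ f (r₁ β ∘H m) f∘r₁α≈r₁β∘m∘k

  f₂ : Hom S G
  f₂ = proj₁ mediating

  f₂∘f₁≈f : f₂ ∘H f₁ ≈H f
  f₂∘f₁≈f = proj₁ (proj₂ mediating)

  f₂∘r₁γ≈r₁β∘m : f₂ ∘H r₁ γ ≈H r₁ β ∘H m
  f₂∘r₁γ≈r₁β∘m = proj₁ (proj₂ (proj₂ mediating))

  private
    module LeftV = StackedSquares {q = fV f₂}
      (proj₁ (proj₁ pushout₂)) (proj₁ f₂∘r₁γ≈r₁β∘m) (proj₁ m∘k≈h) (proj₁ f₂∘f₁≈f)
      (proj₁ covers₁) (proj₁ (r₁-match β)) (proj₁ S-covered)
    module LeftE = StackedSquares {q = fE f₂}
      (proj₂ (proj₁ pushout₂)) (proj₂ f₂∘r₁γ≈r₁β∘m) (proj₂ m∘k≈h) (proj₂ f₂∘f₁≈f)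
      (proj₂ covers₁) (proj₂ (r₁-match β)) (proj₂ S-covered)

  f₂-match : IsMatch f₂
  f₂-match = LeftV.lower-injective (proj₁ f-match) (proj₁ m-match) ,
             LeftE.lower-injective (proj₂ f-match) (proj₂ m-match)

  pullback-lower-left : IsPullback (r₁ γ) m f₂ (r₁ β)
  pullback-lower-left = covers⇒isPullback (r₁ γ) m f₂ (r₁ β) f₂∘r₁γ≈r₁β∘m (r₁-match γ)
    (LeftV.lower-covers , LeftE.lower-covers)

  private
    preserved-in-image₂ =
      isFPBC⇒preserved-in-image (r₂ α) g₁ k (r₂ γ) fpbc₂ (r₂-match α) g₁-match

    -- The dangling condition: an edge of T outside g₁ is sent by g₂ into r₂ β, hence so are its
    -- endpoints, and the pushout H covers compatible pairs, so such endpoints are not deleted.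
    end-preserved : ∀ t → ¬ Image (fE g₁) t → ∀ ε → Preserved (fV g₁) (fV (r₂ α)) (end ε T t)
    end-preserved t ∉ ε with proj₂ H-covered (fE g₂ t)
    ... | inj₁ (x , eq) = contradiction (x , proj₂ g₂-match eq) ∉
    ... | inj₂ (b , eq) = preserved-if-below {q = fV g₂} (proj₁ pushout₁-covers) (end ε T t)
      (end ε (K β) b , trans (end-∘ (r₂ β) ε b) (trans (cong (end ε H) eq) (sym (end-∘ g₂ ε t))))

  T-covered : JointlySurjectiveᴳ g₁ (r₂ γ)
  T-covered = nodes , edges
    where
    nodes : JointlySurjective (fV g₁) (fV (r₂ γ))
    nodes t with image? (fV g₁) t
    ... | yes im = inj₁ im
    ... | no ∉ = inj₂ (proj₁ preserved-in-image₂ t (λ x eq → contradiction (x , eq) ∉))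

    edges : JointlySurjective (fE g₁) (fE (r₂ γ))
    edges t with image? (fE g₁) t
    ... | yes im = inj₁ im
    ... | no ∉ = inj₂ (proj₂ preserved-in-image₂ t
      ((λ x eq → contradiction (x , eq) ∉) , end-preserved t ∉ source , end-preserved t ∉ target))

  private
    module RightV = StackedSquares {q = fV g₂}
      (proj₁ (proj₁ (proj₁ fpbc₂))) (proj₁ g₂∘r₂γ≈r₂β∘m) (proj₁ m∘k≈h) (λ _ → refl)
      (proj₁ pushout₁-covers) (proj₁ (r₂-match β)) (proj₁ T-covered)
    module RightE = StackedSquares {q = fE g₂}
      (proj₂ (proj₁ (proj₁ fpbc₂))) (proj₂ g₂∘r₂γ≈r₂β∘m) (proj₂ m∘k≈h) (λ _ → refl)
      (proj₂ pushout₁-covers) (proj₂ (r₂-match β)) (proj₂ T-covered)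

  pushout-upper-right : IsPushout (r₂ α) k g₁ (r₂ γ)
  pushout-upper-right =
    covers⇒isPushout (r₂ α) k g₁ (r₂ γ) (proj₁ (proj₁ fpbc₂)) g₁-match (r₂-match γ) T-covered covers₂

  pushout-lower-right : IsPushout (r₂ γ) m g₂ (r₂ β)
  pushout-lower-right = covers⇒isPushout (r₂ γ) m g₂ (r₂ β)
    g₂∘r₂γ≈r₂β∘m g₂-match (r₂-match β)
    (jointlySurjective-∘ˡ {j = fV g₁} (proj₁ H-covered) ,
     jointlySurjective-∘ˡ {j = fE g₁} (proj₂ H-covered))
    (RightV.lower-covers , RightE.lower-covers)

  fpbc-upper-left : IsFPBC (r₁ α) f₁ k (r₁ γ)
  fpbc-upper-left = isPushout⇒isFPBC (r₁ α) k f₁ (r₁ γ) pushout₂ (r₁-match α) (r₁-match γ)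

  fpbc-lower-left : IsFPBC (r₁ γ) f₂ m (r₁ β)
  fpbc-lower-left = isFPBC-intro (r₁ γ) f₂ m (r₁ β) pullback-lower-left (r₁-match β) lands
    where
    preserved-in-image₁ = isFPBC⇒preserved-in-image (r₁ α) f h (r₁ β) fpbc₁ (r₁-match α) f-match

    lands : ∀ {P Q} (f' : Hom P S) (g' : Hom P Q) (k' : Hom Q G) → IsPullback f' g' f₂ k' →
      (p : Hom P (K γ)) → r₁ γ ∘H p ≈H f' → LandsIn k' (r₁ β)
    lands f' g' k' test p (r₁γ∘pV , r₁γ∘pE) =
      (λ y → proj₁ preserved-in-image₁ _ (nodes y)) ,
      (λ e → proj₂ preserved-in-image₁ _ (preserved-ends f (r₁ α) k' nodes e (edges e)))
      where
      covers = isPullback⇒covers f' g' f₂ k' test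
      nodes : ∀ y → Preserved (fV f) (fV (r₁ α)) (fV k' y)
      nodes = preserved-under-pullback {q = fV f₂} {p = fV p}
        (proj₁ pushout₂-covers) (proj₁ f₂∘f₁≈f) (proj₁ covers) r₁γ∘pV
      edges : ∀ e → Preserved (fE f) (fE (r₁ α)) (fE k' e)
      edges = preserved-under-pullback {q = fE f₂} {p = fE p}
        (proj₂ pushout₂-covers) (proj₂ f₂∘f₁≈f) (proj₂ covers) r₁γ∘pE

  upper-commutes : CommutesP (rule→P α) (total g₁) (total f₁) (rule→P γ)
  upper-commutes =
    commutesP-intro (rule→P α) (rule→P γ) g₁ f₁ k (proj₁ fpbc-upper-left) (proj₁ (proj₁ fpbc₂))

  lower-commutes : CommutesP (rule→P γ) (total g₂) (total f₂) (rule→P β)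
  lower-commutes = commutesP-intro (rule→P γ) (rule→P β) g₂ f₂ m pullback-lower-left
    g₂∘r₂γ≈r₂β∘m

  f₂-unique : (f₂' : Hom S G) → f₂' ∘H f₁ ≈H f → Derivation γ f₂' g₂ β → f₂' ≈H f₂
  f₂-unique f₂' f₂'∘f₁≈f (h' , _ , fpbc' , pushout' , _) =
    proj₂ (proj₂ (proj₂ mediating)) f₂' f₂'∘f₁≈f f₂'∘r₁γ≈r₁β∘m
    where
    h'≈m : h' ≈H m
    h'≈m = match-cancelˡ (r₂ β) (r₂-match β) h' m (begin
      r₂ β ∘H h'  ≈⟨ proj₁ pushout' ⟨
      g₂ ∘H r₂ γ  ≈⟨ g₂∘r₂γ≈r₂β∘m ⟩
      r₂ β ∘H m   ∎)
      where open Reasoning (Hom-setoid (K γ) H)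

    f₂'∘r₁γ≈r₁β∘m : f₂' ∘H r₁ γ ≈H r₁ β ∘H m
    f₂'∘r₁γ≈r₁β∘m = begin
      f₂' ∘H r₁ γ  ≈⟨ proj₁ (proj₁ fpbc') ⟩
      r₁ β ∘H h'   ≈⟨ ∘-congˡ (r₁ β) {h'} {m} h'≈m ⟩
      r₁ β ∘H m    ∎
      where open Reasoning (Hom-setoid (K γ) G)

lemma2 : ∀ {L R G H S T : Graph}
    (α : Rule L R) (β : Rule G H) (γ : Rule S T)
    (f : Hom L G) (f₁ : Hom L S) (g₁ : Hom R T) (g₂ : Hom T H) →
    IsMatch f → IsMatch f₁ → IsMatch g₁ → IsMatch g₂ →
    Derivation α f (g₂ ∘H g₁) β →
    Derivation (α †) g₁ f₁ (γ †) →
    Σ[ f₂ ∈ Hom S G ]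
      ((IsMatch f₂ × (f₂ ∘H f₁ ≈H f) ×
        CommutesP (rule→P α) (total g₁) (total f₁) (rule→P γ) ×
        CommutesP (rule→P γ) (total g₂) (total f₂) (rule→P β) ×
        Derivation α f₁ g₁ γ × Derivation γ f₂ g₂ β) ×
       (∀ (f₂' : Hom S G) → IsMatch f₂' → f₂' ∘H f₁ ≈H f →
          CommutesP (rule→P α) (total g₁) (total f₁) (rule→P γ) →
          CommutesP (rule→P γ) (total g₂) (total f₂') (rule→P β) →
          Derivation α f₁ g₁ γ → Derivation γ f₂' g₂ β →
          f₂' ≈H f₂))
lemma2 α β γ f f₁ g₁ g₂ f-match _ g₁-match g₂-match
  (h , _ , fpbc₁ , pushout₁ , _) (k , k-match , fpbc₂ , pushout₂ , _) =
  f₂ ,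
  ( f₂-match , f₂∘f₁≈f , upper-commutes , lower-commutes
  , (k , k-match , fpbc-upper-left , pushout-upper-right , g₁-match)
  , (m , m-match , fpbc-lower-left , pushout-lower-right , g₂-match) ) ,
  λ f₂' _ f₂'∘f₁≈f _ _ _ derivation → f₂-unique f₂' f₂'∘f₁≈f derivation
  where
  open BackwardModularity α β γ f f₁ g₁ g₂ f-match g₁-match g₂-match
    h fpbc₁ pushout₁ k fpbc₂ pushout₂
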